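{- For $n>1$ and $s_1,\ldots,s_n\in\mathbb{N}$, $$\prod_{i=1}^n\mathrm{Li}^-_{y_{s_i}}=\sum_{k_1=0}^{s_1}\sum_{k_2=0}^{s_2}\cdots\sum_{k_{n-1}=0}^{s_{n-1}}\Big(\prod_{i=1}^{n-1}(-1)^{k_i}\binom{s_i}{k_i}\Big)\mathrm{Li}^-_{y_{s_1-k_1}y_{s_2-k_2+k_1}\cdots y_{s_{n-1}-k_{n-1}+k_{n-2}}y_{s_n+k_{n-1}}}.$$
   Context: $\mathbb{N}$ is the set of non-negative integers. For $\mathbf{s}=(s_1,\ldots,s_r)\in\mathbb{N}^r$ put $\mathrm{Li}^-_{\mathbf{s}}(z):=\sum_{n_1>\cdots>n_r>0}n_1^{s_1}\cdots n_r^{s_r}z^{n_1}$ for $|z|<1$; each is a rational function in $\mathbb{Q}[z,(1-z)^{ -1}]$, and products are products of these functions. For a word $y_{t_1}\cdots y_{t_r}$ in letters $y_0,y_1,\ldots$, $\mathrm{Li}^-_{y_{t_1}\cdots y_{t_r}}:=\mathrm{Li}^-_{(t_1,\ldots,t_r)}$. -}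

module Defs where

open import Data.Nat as ℕ using (ℕ; zero; suc)
open import Data.Nat.Combinatorics using (_C_)
open import Data.Integer as ℤ using (ℤ; +_; -[1+_])
open import Data.List using (List; []; _∷_; map; foldr; concatMap; upTo)

-- Formal power series over ℤ, represented by their coefficient sequences:
-- a series f corresponds to Σ_N f N z^N.
Series : Set
Series = ℕ → ℤ

sumℤ : List ℤ → ℤ
sumℤ = foldr ℤ._+_ (+ 0)

sumTo : ℕ → (ℕ → ℤ) → ℤ
sumTo N f = sumℤ (map f (upTo (suc N)))

-- Cauchy product of formal power series (= product of the functions on |z|<1)
_⊛_ : Series → Series → Series
(f ⊛ g) N = sumTo N (λ i → f i ℤ.* g (N ℕ.∸ i))

oneS : Series
oneS zero    = + 1
oneS (suc _) = + 0

sumS : List Series → Series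
sumS fs N = sumℤ (map (λ f → f N) fs)

_·S_ : ℤ → Series → Series
(c ·S f) N = c ℤ.* f N


sumOpen : ℕ → (ℕ → ℤ) → ℤ
sumOpen m g = sumℤ (map (λ j → g (suc j)) (upTo (m ℕ.∸ 1)))

-- A ts m = Σ_{m > n₂ > ⋯ > n_r > 0} n₂^{t₂} ⋯ n_r^{t_r}
A : List ℕ → ℕ → ℤ
A []       m = + 1
A (t ∷ ts) m = sumOpen m (λ j → (+ (j ℕ.^ t)) ℤ.* A ts j)

-- Coefficient series of Li⁻_{(t₁,…,t_r)}(z) = Σ_{n₁>⋯>n_r>0} n₁^{t₁}⋯n_r^{t_r} z^{n₁}.
-- (For the empty word this gives the constant 1; not used below.)
Li⁻ : List ℕ → Series
Li⁻ []       = oneS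
Li⁻ (t ∷ ts) zero    = + 0
Li⁻ (t ∷ ts) (suc N) = (+ (suc N ℕ.^ t)) ℤ.* A ts (suc N)

prodLi : List ℕ → Series
prodLi ss = foldr (λ s acc → Li⁻ (s ∷ []) ⊛ acc) oneS ss

-- all (k₁,…,k_{n-1}) with 0 ≤ kᵢ ≤ sᵢ, for s = (s₁,…,s_n) (last entry ignored)
boxesInit : List ℕ → List (List ℕ)
boxesInit []            = [] ∷ []
boxesInit (_ ∷ [])      = [] ∷ []
boxesInit (x ∷ y ∷ r)   = concatMap (λ k → map (k ∷_) (boxesInit (y ∷ r))) (upTo (suc x))

-- the word (s₁-k₁, s₂-k₂+k₁, …, s_{n-1}-k_{n-1}+k_{n-2}, s_n+k_{n-1}),
-- c is the carried k_{i-1} (k₀ = 0)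
wordAux : ℕ → List ℕ → List ℕ → List ℕ
wordAux c []       _        = []
wordAux c (s ∷ []) _        = (s ℕ.+ c) ∷ []
wordAux c (s ∷ ss@(_ ∷ _)) []       = (s ℕ.+ c) ∷ wordAux 0 ss []
wordAux c (s ∷ ss@(_ ∷ _)) (k ∷ ks) = ((s ℕ.∸ k) ℕ.+ c) ∷ wordAux k ss ks

word : List ℕ → List ℕ → List ℕ
word s k = wordAux 0 s k

coeff : List ℕ → List ℕ → ℤ
coeff (s ∷ ss) (k ∷ ks) = ((ℤ.- (+ 1)) ℤ.^ k) ℤ.* (+ (s C k)) ℤ.* coeff ss ks
coeff _        _        = + 1

rhs : List ℕ → Series
rhs s = sumS (map (λ k → coeff s k ·S Li⁻ (word s k)) (boxesInit s))

-- For a word t·u, the coefficient of z^N in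
-- Li⁻_{y_a} · Li⁻_{t u} is Σ_{0<n<N} (N - n)^a n^t A_u(n), and expanding (N - n)^a by the
-- binomial theorem gives Σ_k (-1)^k C(a,k) Li⁻_{(a-k, t+k, u)}. Prepending the letter a with
-- index k to a word of the right-hand side does exactly this: the new first letter is a - k
-- and the old first letter is raised by k. So both sides obey the same recursion in n.

module Submission where

open import Defs
open import Data.Nat using (ℕ; _<_)
open import Data.List using (List; length)
open import Relation.Binary.PropositionalEquality using (_≡_)

open import Data.Nat as ℕ using (zero; suc; _∸_; _≤_)
import Data.Nat.Properties as ℕₚ
open import Data.Nat.Combinatorics using (_C_)
open import Data.Integer using (ℤ; +_; 0ℤ; 1ℤ; _+_; _*_; -_; _^_)
import Data.Integer.Properties as ℤₚ
open import Data.Integer.Tactic.RingSolver using (solve-∀)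
open import Data.Fin using (Fin; toℕ; fromℕ; inject₁; opposite)
import Data.Fin.Properties as Finₚ
open import Data.Fin.Permutation using (reverse)
open import Data.List using ([]; _∷_; _++_; map; concatMap; applyUpTo; upTo)
import Data.List.Properties as Listₚ
open import Data.Product using (Σ-syntax; _×_; _,_)
open import Function using (_∘_)
open import Relation.Binary.PropositionalEquality
  using (refl; sym; trans; cong; cong₂; _≗_; module ≡-Reasoning)
open import Algebra.Properties.Semiring.Sum ℤₚ.+-*-semiring
  using ( sum; sum-syntax; sum-cong-≗; sum-replicate-zero; sum-init-last
        ; ∑-distrib-+; ∑-comm; ∑-permute; *-distribˡ-sum; *-distribʳ-sum)
open import Algebra.Properties.CommutativeSemigroup ℤₚ.*-commutativeSemigroup
  using (x∙yz≈y∙xz; xy∙z≈y∙xz; x∙yz≈yx∙z)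
open import Algebra.Properties.Semiring.Exp ℤₚ.+-*-semiring using () renaming (_^_ to _^ᴿ_)
open import Algebra.Properties.Semiring.Mult ℤₚ.+-*-semiring using () renaming (_×_ to _×ᴿ_)
import Algebra.Properties.CommutativeSemiring.Binomial ℤₚ.+-*-commutativeSemiring as Binomial
open ≡-Reasoning

sumℤ-cong : ∀ {A : Set} {f g : A → ℤ} → f ≗ g → ∀ xs → sumℤ (map f xs) ≡ sumℤ (map g xs)
sumℤ-cong f≗g xs = cong sumℤ (Listₚ.map-cong f≗g xs)

sumℤ-++ : ∀ xs ys → sumℤ (xs ++ ys) ≡ sumℤ xs + sumℤ ys
sumℤ-++ []       ys = sym (ℤₚ.+-identityˡ (sumℤ ys))
sumℤ-++ (x ∷ xs) ys =
  trans (cong (_+_ x) (sumℤ-++ xs ys)) (sym (ℤₚ.+-assoc x (sumℤ xs) (sumℤ ys)))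

sumℤ-concatMap : ∀ {A B : Set} (f : B → ℤ) (g : A → List B) xs →
                 sumℤ (map f (concatMap g xs)) ≡ sumℤ (map (λ x → sumℤ (map f (g x))) xs)
sumℤ-concatMap f g []       = refl
sumℤ-concatMap f g (x ∷ xs) = begin
  sumℤ (map f (g x ++ concatMap g xs))               ≡⟨ cong sumℤ (Listₚ.map-++ f (g x) _) ⟩
  sumℤ (map f (g x) ++ map f (concatMap g xs))       ≡⟨ sumℤ-++ (map f (g x)) _ ⟩
  sumℤ (map f (g x)) + sumℤ (map f (concatMap g xs)) ≡⟨ cong (_+_ (sumℤ (map f (g x))))
                                                             (sumℤ-concatMap f g xs) ⟩
  sumℤ (map f (g x)) + sumℤ (map (λ y → sumℤ (map f (g y))) xs) ∎

sumℤ-applyUpTo : ∀ (f : ℕ → ℤ) g n → sumℤ (map f (applyUpTo g n)) ≡ ∑[ i < n ] f (g (toℕ i))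
sumℤ-applyUpTo f g zero    = refl
sumℤ-applyUpTo f g (suc n) = cong (_+_ (f (g 0))) (sumℤ-applyUpTo f (g ∘ suc) n)

sumℤ-upTo : ∀ (f : ℕ → ℤ) n → sumℤ (map f (upTo n)) ≡ ∑[ i < n ] f (toℕ i)
sumℤ-upTo f = sumℤ-applyUpTo f (λ i → i)

*-distribˡ-sumℤ : ∀ {A : Set} c (f : A → ℤ) xs →
                  c * sumℤ (map f xs) ≡ sumℤ (map (λ x → c * f x) xs)
*-distribˡ-sumℤ c f []       = ℤₚ.*-zeroʳ c
*-distribˡ-sumℤ c f (x ∷ xs) =
  trans (ℤₚ.*-distribˡ-+ c (f x) _) (cong (_+_ (c * f x)) (*-distribˡ-sumℤ c f xs))

sumℤ-∑-comm : ∀ {A : Set} {n} (f : A → Fin n → ℤ) xs →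
              sumℤ (map (λ x → ∑[ i < n ] f x i) xs) ≡ ∑[ i < n ] sumℤ (map (λ x → f x i) xs)
sumℤ-∑-comm {n = n} f []       = sym (sum-replicate-zero n)
sumℤ-∑-comm         f (x ∷ xs) =
  trans (cong (_+_ (sum (f x))) (sumℤ-∑-comm f xs)) (sym (∑-distrib-+ (f x) _))

⊛-coeff : ∀ f g N → (f ⊛ g) N ≡ ∑[ i < suc N ] (f (toℕ i) * g (N ∸ toℕ i))
⊛-coeff f g N = sumℤ-upTo (λ i → f i * g (N ∸ i)) (suc N)

⊛-comm : ∀ f g N → (f ⊛ g) N ≡ (g ⊛ f) N
⊛-comm f g N = begin
  (f ⊛ g) N
    ≡⟨ ⊛-coeff f g N ⟩
  ∑[ i < suc N ] (f (toℕ i) * g (N ∸ toℕ i))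
    ≡⟨ ∑-permute (λ i → f (toℕ i) * g (N ∸ toℕ i)) reverse ⟩
  ∑[ i < suc N ] (f (toℕ (opposite i)) * g (N ∸ toℕ (opposite i)))
    ≡⟨ sum-cong-≗ reflect ⟩
  ∑[ i < suc N ] (g (toℕ i) * f (N ∸ toℕ i))
    ≡⟨ ⊛-coeff g f N ⟨
  (g ⊛ f) N ∎
  where
  reflect : (i : Fin (suc N)) →
            f (toℕ (opposite i)) * g (N ∸ toℕ (opposite i)) ≡ g (toℕ i) * f (N ∸ toℕ i)
  reflect i = begin
    f (toℕ (opposite i)) * g (N ∸ toℕ (opposite i))
      ≡⟨ cong (λ n → f n * g (N ∸ n)) (Finₚ.opposite-prop i) ⟩
    f (N ∸ toℕ i) * g (N ∸ (N ∸ toℕ i))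
      ≡⟨ cong (λ n → f (N ∸ toℕ i) * g n) (ℕₚ.m∸[m∸n]≡n (Finₚ.toℕ≤pred[n] i)) ⟩
    f (N ∸ toℕ i) * g (toℕ i)
      ≡⟨ ℤₚ.*-comm (f (N ∸ toℕ i)) (g (toℕ i)) ⟩
    g (toℕ i) * f (N ∸ toℕ i) ∎

⊛-congʳ : ∀ f {g h} → g ≗ h → ∀ N → (f ⊛ g) N ≡ (f ⊛ h) N
⊛-congʳ f g≗h N = sumℤ-cong (λ i → cong (f i *_) (g≗h (N ∸ i))) (upTo (suc N))

⊛-identityʳ : ∀ f N → (f ⊛ oneS) N ≡ f N
⊛-identityʳ f N = begin
  (f ⊛ oneS) N              ≡⟨ ⊛-comm f oneS N ⟩
  (oneS ⊛ f) N              ≡⟨ ⊛-coeff oneS f N ⟩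
  1ℤ * f N + ∑[ i < N ] 0ℤ  ≡⟨ cong₂ _+_ (ℤₚ.*-identityˡ (f N)) (sum-replicate-zero N) ⟩
  f N + 0ℤ                  ≡⟨ ℤₚ.+-identityʳ (f N) ⟩
  f N                       ∎

⊛-coeff-suc : ∀ {f g} → f 0 ≡ 0ℤ → g 0 ≡ 0ℤ →
              ∀ M → (f ⊛ g) (suc M) ≡ ∑[ j < M ] (f (suc (toℕ j)) * g (M ∸ toℕ j))
⊛-coeff-suc {f} {g} f0≡0 g0≡0 M = begin
  (f ⊛ g) (suc M)                        ≡⟨ ⊛-coeff f g (suc M) ⟩
  f 0 * g (suc M) + ∑[ i < suc M ] h i   ≡⟨ cong (λ x → x * g (suc M) + ∑[ i < suc M ] h i) f0≡0 ⟩
  0ℤ + ∑[ i < suc M ] h i                ≡⟨ ℤₚ.+-identityˡ _ ⟩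
  ∑[ i < suc M ] h i                     ≡⟨ sum-init-last h ⟩
  ∑[ j < M ] h (inject₁ j) + h (fromℕ M) ≡⟨ cong₂ _+_ (sum-cong-≗ {M} (cong h′ ∘ Finₚ.toℕ-inject₁))
                                                      h[M]≡0 ⟩
  ∑[ j < M ] h′ (toℕ j) + 0ℤ             ≡⟨ ℤₚ.+-identityʳ _ ⟩
  ∑[ j < M ] h′ (toℕ j)                  ∎
  where
  h′ : ℕ → ℤ
  h′ n = f (suc n) * g (M ∸ n)
  h : Fin (suc M) → ℤ
  h i = h′ (toℕ i)
  h[M]≡0 : h (fromℕ M) ≡ 0ℤ
  h[M]≡0 = begin
    h′ (toℕ (fromℕ M))    ≡⟨ cong h′ (Finₚ.toℕ-fromℕ M) ⟩
    f (suc M) * g (M ∸ M) ≡⟨ cong (λ n → f (suc M) * g n) (ℕₚ.n∸n≡0 M) ⟩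
    f (suc M) * g 0       ≡⟨ cong (f (suc M) *_) g0≡0 ⟩
    f (suc M) * 0ℤ        ≡⟨ ℤₚ.*-zeroʳ (f (suc M)) ⟩
    0ℤ                    ∎

sumS-map : ∀ {A : Set} (φ : A → Series) xs N → sumS (map φ xs) N ≡ sumℤ (map (λ x → φ x N) xs)
sumS-map φ xs N = cong sumℤ (sym (Listₚ.map-∘ xs))

⊛-distribˡ-lincomb : ∀ {A : Set} f (c : A → ℤ) (g : A → Series) xs N →
  (f ⊛ sumS (map (λ x → c x ·S g x) xs)) N ≡ sumℤ (map (λ x → c x * (f ⊛ g x) N) xs)
⊛-distribˡ-lincomb f c g xs N = begin
  (f ⊛ G) N
    ≡⟨ ⊛-coeff f G N ⟩
  ∑[ i < suc N ] (f (toℕ i) * G (N ∸ toℕ i))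
    ≡⟨ sum-cong-≗ {suc N} distribute ⟩
  ∑[ i < suc N ] sumℤ (map (λ x → f (toℕ i) * (c x * g x (N ∸ toℕ i))) xs)
    ≡⟨ sumℤ-∑-comm {n = suc N} (λ x i → f (toℕ i) * (c x * g x (N ∸ toℕ i))) xs ⟨
  sumℤ (map (λ x → ∑[ i < suc N ] (f (toℕ i) * (c x * g x (N ∸ toℕ i)))) xs)
    ≡⟨ sumℤ-cong pull-scalar xs ⟩
  sumℤ (map (λ x → c x * (f ⊛ g x) N) xs) ∎
  where
  G : Series
  G = sumS (map (λ x → c x ·S g x) xs)
  distribute : (i : Fin (suc N)) →
    f (toℕ i) * G (N ∸ toℕ i) ≡ sumℤ (map (λ x → f (toℕ i) * (c x * g x (N ∸ toℕ i))) xs)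
  distribute i = trans (cong (f (toℕ i) *_) (sumS-map (λ x → c x ·S g x) xs (N ∸ toℕ i)))
                       (*-distribˡ-sumℤ (f (toℕ i)) (λ x → c x * g x (N ∸ toℕ i)) xs)
  pull-scalar : ∀ x → ∑[ i < suc N ] (f (toℕ i) * (c x * g x (N ∸ toℕ i))) ≡ c x * (f ⊛ g x) N
  pull-scalar x = begin
    ∑[ i < suc N ] (f (toℕ i) * (c x * g x (N ∸ toℕ i)))
      ≡⟨ sum-cong-≗ {suc N} (λ i → x∙yz≈y∙xz (f (toℕ i)) (c x) (g x (N ∸ toℕ i))) ⟩
    ∑[ i < suc N ] (c x * (f (toℕ i) * g x (N ∸ toℕ i)))
      ≡⟨ *-distribˡ-sum {suc N} (c x) (λ i → f (toℕ i) * g x (N ∸ toℕ i)) ⟨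
    c x * ∑[ i < suc N ] (f (toℕ i) * g x (N ∸ toℕ i))
      ≡⟨ cong (c x *_) (⊛-coeff f (g x) N) ⟨
    c x * (f ⊛ g x) N ∎

pos-^ : ∀ m n → + (m ℕ.^ n) ≡ (+ m) ^ n
pos-^ m zero    = refl
pos-^ m (suc n) = trans (ℤₚ.pos-* m (m ℕ.^ n)) (cong ((+ m) *_) (pos-^ m n))

pos-∸ : ∀ {m n} → n ≤ m → + (m ∸ n) ≡ - + n + + m
pos-∸ {m} {n} n≤m = trans (sym (ℤₚ.⊖-≥ n≤m)) (sym (ℤₚ.-m+n≡n⊖m n m))

neg-^ : ∀ x k → (- x) ^ k ≡ (- 1ℤ) ^ k * x ^ k
neg-^ x zero    = refl
neg-^ x (suc k) = trans (cong (- x *_) (neg-^ x k)) (regroup x ((- 1ℤ) ^ k) (x ^ k))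
  where
  regroup : ∀ x s p → - x * (s * p) ≡ (- 1ℤ * s) * (x * p)
  regroup = solve-∀

^ᴿ≡^ : ∀ x n → x ^ᴿ n ≡ x ^ n
^ᴿ≡^ x zero    = refl
^ᴿ≡^ x (suc n) = cong (x *_) (^ᴿ≡^ x n)

×ᴿ≡* : ∀ n x → n ×ᴿ x ≡ + n * x
×ᴿ≡* zero    x = sym (ℤₚ.*-zeroˡ x)
×ᴿ≡* (suc n) x = trans (cong (_+_ x) (×ᴿ≡* n x)) (sym (ℤₚ.suc-* (+ n) x))

binomial : ∀ a x y →
  (x + y) ^ a ≡ ∑[ k < suc a ] (+ (a C toℕ k) * (x ^ toℕ k * y ^ (a ∸ toℕ k)))
binomial a x y = begin
  (x + y) ^ a                      ≡⟨ ^ᴿ≡^ (x + y) a ⟨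
  (x + y) ^ᴿ a                     ≡⟨ Binomial.theorem a x y ⟩
  Binomial.binomialExpansion x y a ≡⟨ sum-cong-≗ {suc a} term ⟩
  ∑[ k < suc a ] (+ (a C toℕ k) * (x ^ toℕ k * y ^ (a ∸ toℕ k))) ∎
  where
  term : (k : Fin (suc a)) → (a C toℕ k) ×ᴿ (x ^ᴿ toℕ k * y ^ᴿ (a ∸ toℕ k))
                           ≡ + (a C toℕ k) * (x ^ toℕ k * y ^ (a ∸ toℕ k))
  term k = trans (×ᴿ≡* (a C toℕ k) _)
                 (cong₂ (λ p q → + (a C toℕ k) * (p * q)) (^ᴿ≡^ x (toℕ k)) (^ᴿ≡^ y (a ∸ toℕ k)))

signedBinom : ℕ → ℕ → ℤ
signedBinom a k = (- 1ℤ) ^ k * + (a C k)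

binomial-sub : ∀ a x y →
  (- y + x) ^ a ≡ ∑[ k < suc a ] (signedBinom a (toℕ k) * x ^ (a ∸ toℕ k) * y ^ toℕ k)
binomial-sub a x y = trans (binomial a (- y) x) (sum-cong-≗ {suc a} term)
  where
  regroup : ∀ c s q p → c * ((s * q) * p) ≡ ((s * c) * p) * q
  regroup = solve-∀
  term : (k : Fin (suc a)) → + (a C toℕ k) * ((- y) ^ toℕ k * x ^ (a ∸ toℕ k))
                           ≡ signedBinom a (toℕ k) * x ^ (a ∸ toℕ k) * y ^ toℕ k
  term k = trans (cong (λ p → + (a C toℕ k) * (p * x ^ (a ∸ toℕ k))) (neg-^ y (toℕ k)))
                 (regroup (+ (a C toℕ k)) ((- 1ℤ) ^ toℕ k) (y ^ toℕ k) (x ^ (a ∸ toℕ k)))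

Li⁻-singleton-pos : ∀ a {n} → 0 < n → Li⁻ (a ∷ []) n ≡ (+ n) ^ a
Li⁻-singleton-pos a {suc n} _ = trans (ℤₚ.*-identityʳ (+ (suc n ℕ.^ a))) (pos-^ (suc n) a)

Li⁻-raise-head : ∀ t k ts n →
  Li⁻ ((t ℕ.+ k) ∷ ts) (suc n) ≡ (+ suc n) ^ k * Li⁻ (t ∷ ts) (suc n)
Li⁻-raise-head t k ts n = begin
  + (m ℕ.^ (t ℕ.+ k)) * A ts m          ≡⟨ cong (λ e → + e * A ts m) (ℕₚ.^-distribˡ-+-* m t k) ⟩
  + (m ℕ.^ t ℕ.* m ℕ.^ k) * A ts m      ≡⟨ cong (_* A ts m) (ℤₚ.pos-* (m ℕ.^ t) (m ℕ.^ k)) ⟩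
  + (m ℕ.^ t) * + (m ℕ.^ k) * A ts m    ≡⟨ xy∙z≈y∙xz (+ (m ℕ.^ t)) (+ (m ℕ.^ k)) (A ts m) ⟩
  + (m ℕ.^ k) * (+ (m ℕ.^ t) * A ts m)  ≡⟨ cong (_* Li⁻ (t ∷ ts) m) (pos-^ m k) ⟩
  (+ m) ^ k * Li⁻ (t ∷ ts) m            ∎
  where
  m = suc n

Li⁻-cons-suc : ∀ u t ts M →
  Li⁻ (u ∷ t ∷ ts) (suc M) ≡ (+ suc M) ^ u * ∑[ j < M ] Li⁻ (t ∷ ts) (suc (toℕ j))
Li⁻-cons-suc u t ts M =
  cong₂ _*_ (pos-^ (suc M) u) (sumℤ-upTo (λ j → Li⁻ (t ∷ ts) (suc j)) M)

Li⁻-singleton-⊛ : ∀ a t ts N →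
  (Li⁻ (a ∷ []) ⊛ Li⁻ (t ∷ ts)) N
    ≡ ∑[ k < suc a ] (signedBinom a (toℕ k) * Li⁻ ((a ∸ toℕ k) ∷ (t ℕ.+ toℕ k) ∷ ts) N)
Li⁻-singleton-⊛ a t ts zero = sym (begin
  ∑[ k < suc a ] (signedBinom a (toℕ k) * 0ℤ)
    ≡⟨ sum-cong-≗ {suc a} (λ k → ℤₚ.*-zeroʳ (signedBinom a (toℕ k))) ⟩
  ∑[ k < suc a ] 0ℤ
    ≡⟨ sum-replicate-zero (suc a) ⟩
  0ℤ ∎)
Li⁻-singleton-⊛ a t ts (suc M) = begin
  (Li⁻ (a ∷ []) ⊛ L) (suc M)
    ≡⟨ ⊛-comm (Li⁻ (a ∷ [])) L (suc M) ⟩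
  (L ⊛ Li⁻ (a ∷ [])) (suc M)
    ≡⟨ ⊛-coeff-suc {L} {Li⁻ (a ∷ [])} refl refl M ⟩
  ∑[ j < M ] (L (y j) * Li⁻ (a ∷ []) (M ∸ toℕ j))
    ≡⟨ sum-cong-≗ {M} (λ j → trans (cong (L (y j) *_) (gap j))
                                   (ℤₚ.*-comm (L (y j)) ((- Y j + X) ^ a))) ⟩
  ∑[ j < M ] ((- Y j + X) ^ a * L (y j))
    ≡⟨ sum-cong-≗ {M} (λ j → cong (_* L (y j)) (binomial-sub a X (Y j))) ⟩
  ∑[ j < M ] (∑[ k < suc a ] (c k * X ^ (a ∸ toℕ k) * Y j ^ toℕ k) * L (y j))
    ≡⟨ sum-cong-≗ {M} (λ j → *-distribʳ-sum {suc a} (L (y j)) (λ k → c k * X ^ (a ∸ toℕ k) * Y j ^ toℕ k)) ⟩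
  ∑[ j < M ] ∑[ k < suc a ] (c k * X ^ (a ∸ toℕ k) * Y j ^ toℕ k * L (y j))
    ≡⟨ ∑-comm {M} {suc a} (λ j k → c k * X ^ (a ∸ toℕ k) * Y j ^ toℕ k * L (y j)) ⟩
  ∑[ k < suc a ] ∑[ j < M ] (c k * X ^ (a ∸ toℕ k) * Y j ^ toℕ k * L (y j))
    ≡⟨ sum-cong-≗ {suc a} factor ⟩
  ∑[ k < suc a ] (c k * (X ^ (a ∸ toℕ k) * ∑[ j < M ] Li⁻ ((t ℕ.+ toℕ k) ∷ ts) (y j)))
    ≡⟨ sum-cong-≗ {suc a} (λ k → cong (c k *_) (Li⁻-cons-suc (a ∸ toℕ k) (t ℕ.+ toℕ k) ts M)) ⟨
  ∑[ k < suc a ] (c k * Li⁻ ((a ∸ toℕ k) ∷ (t ℕ.+ toℕ k) ∷ ts) (suc M)) ∎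
  where
  L : Series
  L = Li⁻ (t ∷ ts)
  X : ℤ
  X = + suc M
  y : Fin M → ℕ
  y j = suc (toℕ j)
  Y : Fin M → ℤ
  Y j = + y j
  c : Fin (suc a) → ℤ
  c k = signedBinom a (toℕ k)
  gap : (j : Fin M) → Li⁻ (a ∷ []) (M ∸ toℕ j) ≡ (- Y j + X) ^ a
  gap j = trans (Li⁻-singleton-pos a (ℕₚ.m<n⇒0<n∸m (Finₚ.toℕ<n j)))
                (cong (_^ a) (pos-∸ (ℕₚ.m≤n⇒m≤1+n (Finₚ.toℕ<n j))))
  factor : (k : Fin (suc a)) →
           ∑[ j < M ] (c k * X ^ (a ∸ toℕ k) * Y j ^ toℕ k * L (y j))
             ≡ c k * (X ^ (a ∸ toℕ k) * ∑[ j < M ] Li⁻ ((t ℕ.+ toℕ k) ∷ ts) (y j))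
  factor k = begin
    ∑[ j < M ] (cX * Y j ^ toℕ k * L (y j))
      ≡⟨ sum-cong-≗ {M} (λ j → ℤₚ.*-assoc cX (Y j ^ toℕ k) (L (y j))) ⟩
    ∑[ j < M ] (cX * (Y j ^ toℕ k * L (y j)))
      ≡⟨ sum-cong-≗ {M} (λ j → cong (cX *_) (Li⁻-raise-head t (toℕ k) ts (toℕ j))) ⟨
    ∑[ j < M ] (cX * Li⁻ ((t ℕ.+ toℕ k) ∷ ts) (y j))
      ≡⟨ *-distribˡ-sum {M} cX (λ j → Li⁻ ((t ℕ.+ toℕ k) ∷ ts) (y j)) ⟨
    cX * ∑[ j < M ] Li⁻ ((t ℕ.+ toℕ k) ∷ ts) (y j)
      ≡⟨ ℤₚ.*-assoc (c k) (X ^ (a ∸ toℕ k)) _ ⟩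
    c k * (X ^ (a ∸ toℕ k) * ∑[ j < M ] Li⁻ ((t ℕ.+ toℕ k) ∷ ts) (y j)) ∎
    where
    cX = c k * X ^ (a ∸ toℕ k)

word-∷ : ∀ b r ks → Σ[ t ∈ ℕ ] Σ[ ts ∈ List ℕ ]
  word (b ∷ r) ks ≡ t ∷ ts × (∀ a k → word (a ∷ b ∷ r) (k ∷ ks) ≡ (a ∸ k) ∷ (t ℕ.+ k) ∷ ts)
word-∷ b []      ks        =
  b , _ , cong₂ _∷_ (ℕₚ.+-identityʳ b) refl , λ a k → cong₂ _∷_ (ℕₚ.+-identityʳ (a ∸ k)) refl
word-∷ b (_ ∷ _) []        =
  b , _ , cong₂ _∷_ (ℕₚ.+-identityʳ b) refl , λ a k → cong₂ _∷_ (ℕₚ.+-identityʳ (a ∸ k)) refl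
word-∷ b (_ ∷ _) (k′ ∷ ks) =
  b ∸ k′ , _ , cong₂ _∷_ (ℕₚ.+-identityʳ (b ∸ k′)) refl , λ a k → cong₂ _∷_ (ℕₚ.+-identityʳ (a ∸ k)) refl

Li⁻-singleton-⊛-word : ∀ a b r ks N →
  (Li⁻ (a ∷ []) ⊛ Li⁻ (word (b ∷ r) ks)) N
    ≡ ∑[ k < suc a ] (signedBinom a (toℕ k) * Li⁻ (word (a ∷ b ∷ r) (toℕ k ∷ ks)) N)
Li⁻-singleton-⊛-word a b r ks N with word-∷ b r ks
... | t , ts , w≡t∷ts , prepend = begin
  (Li⁻ (a ∷ []) ⊛ Li⁻ (word (b ∷ r) ks)) N
    ≡⟨ cong (λ w → (Li⁻ (a ∷ []) ⊛ Li⁻ w) N) w≡t∷ts ⟩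
  (Li⁻ (a ∷ []) ⊛ Li⁻ (t ∷ ts)) N
    ≡⟨ Li⁻-singleton-⊛ a t ts N ⟩
  ∑[ k < suc a ] (signedBinom a (toℕ k) * Li⁻ ((a ∸ toℕ k) ∷ (t ℕ.+ toℕ k) ∷ ts) N)
    ≡⟨ sum-cong-≗ {suc a} (λ k → cong (λ w → signedBinom a (toℕ k) * Li⁻ w N) (prepend a (toℕ k))) ⟨
  ∑[ k < suc a ] (signedBinom a (toℕ k) * Li⁻ (word (a ∷ b ∷ r) (toℕ k ∷ ks)) N) ∎

rhsTerm : List ℕ → ℕ → List ℕ → ℤ
rhsTerm s N ks = coeff s ks * Li⁻ (word s ks) N

rhs-∷ : ∀ a b r N → rhs (a ∷ b ∷ r) N
  ≡ ∑[ k < suc a ] sumℤ (map (λ ks → rhsTerm (a ∷ b ∷ r) N (toℕ k ∷ ks)) (boxesInit (b ∷ r)))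
rhs-∷ a b r N = begin
  rhs s N
    ≡⟨ sumS-map (λ ks → coeff s ks ·S Li⁻ (word s ks)) boxes N ⟩
  sumℤ (map (rhsTerm s N) boxes)
    ≡⟨ sumℤ-concatMap (rhsTerm s N) (λ k → map (k ∷_) B) (upTo (suc a)) ⟩
  sumℤ (map (λ k → sumℤ (map (rhsTerm s N) (map (k ∷_) B))) (upTo (suc a)))
    ≡⟨ sumℤ-cong (λ k → cong sumℤ (Listₚ.map-∘ B)) (upTo (suc a)) ⟨
  sumℤ (map (λ k → sumℤ (map (λ ks → rhsTerm s N (k ∷ ks)) B)) (upTo (suc a)))
    ≡⟨ sumℤ-upTo (λ k → sumℤ (map (λ ks → rhsTerm s N (k ∷ ks)) B)) (suc a) ⟩
  ∑[ k < suc a ] sumℤ (map (λ ks → rhsTerm s N (toℕ k ∷ ks)) B) ∎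
  where
  s = a ∷ b ∷ r
  B = boxesInit (b ∷ r)
  boxes = boxesInit s

prodLi≗rhs : ∀ s → prodLi s ≗ rhs s
prodLi≗rhs []                N = sym (trans (ℤₚ.+-identityʳ (1ℤ * oneS N)) (ℤₚ.*-identityˡ (oneS N)))
prodLi≗rhs (b ∷ [])          N = begin
  (Li⁻ (b ∷ []) ⊛ oneS) N      ≡⟨ ⊛-identityʳ (Li⁻ (b ∷ [])) N ⟩
  Li⁻ (b ∷ []) N               ≡⟨ cong (λ t → Li⁻ (t ∷ []) N) (ℕₚ.+-identityʳ b) ⟨
  Li⁻ ((b ℕ.+ 0) ∷ []) N       ≡⟨ ℤₚ.*-identityˡ _ ⟨
  1ℤ * Li⁻ ((b ℕ.+ 0) ∷ []) N  ≡⟨ ℤₚ.+-identityʳ _ ⟨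
  rhs (b ∷ []) N               ∎
prodLi≗rhs (a ∷ s@(b ∷ r)) N = begin
  (Li⁻ (a ∷ []) ⊛ prodLi s) N
    ≡⟨ ⊛-congʳ (Li⁻ (a ∷ [])) (prodLi≗rhs s) N ⟩
  (Li⁻ (a ∷ []) ⊛ rhs s) N
    ≡⟨ ⊛-distribˡ-lincomb (Li⁻ (a ∷ [])) (coeff s) (Li⁻ ∘ word s) B N ⟩
  sumℤ (map (λ ks → coeff s ks * (Li⁻ (a ∷ []) ⊛ Li⁻ (word s ks)) N) B)
    ≡⟨ sumℤ-cong (λ ks → cong (coeff s ks *_) (Li⁻-singleton-⊛-word a b r ks N)) B ⟩
  sumℤ (map (λ ks → coeff s ks * ∑[ k < suc a ] (d k * L k ks)) B)
    ≡⟨ sumℤ-cong distribute B ⟩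
  sumℤ (map (λ ks → ∑[ k < suc a ] rhsTerm (a ∷ s) N (toℕ k ∷ ks)) B)
    ≡⟨ sumℤ-∑-comm {n = suc a} (λ ks k → rhsTerm (a ∷ s) N (toℕ k ∷ ks)) B ⟩
  ∑[ k < suc a ] sumℤ (map (λ ks → rhsTerm (a ∷ s) N (toℕ k ∷ ks)) B)
    ≡⟨ rhs-∷ a b r N ⟨
  rhs (a ∷ s) N ∎
  where
  B = boxesInit s
  d : Fin (suc a) → ℤ
  d k = signedBinom a (toℕ k)
  L : Fin (suc a) → List ℕ → ℤ
  L k ks = Li⁻ (word (a ∷ s) (toℕ k ∷ ks)) N
  distribute : ∀ ks → coeff s ks * ∑[ k < suc a ] (d k * L k ks)
                    ≡ ∑[ k < suc a ] rhsTerm (a ∷ s) N (toℕ k ∷ ks)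
  distribute ks = trans (*-distribˡ-sum {suc a} (coeff s ks) (λ k → d k * L k ks))
                        (sum-cong-≗ {suc a} (λ k → x∙yz≈yx∙z (coeff s ks) (d k) (L k ks)))

-- The identity also holds for n ≤ 1.
corollary4p7 : (s : List ℕ) → 1 < length s → (N : ℕ) → prodLi s N ≡ rhs s N
corollary4p7 s _ = prodLi≗rhs s
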